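{- Let $U$ be a set with at least two elements and $\pi$ a partition on $U$. Let $\mathcal{B}_\pi=\{\sigma\Rightarrow\pi:\sigma\in\Pi(U)\}$, ordered by refinement $\preceq$, and let $\pi_{ns}$ be the set of non-singleton blocks of $\pi$. Then $\mathcal{B}_\pi\cong\mathcal{P}(\pi_{ns})$ (the powerset Boolean algebra of $\pi_{ns}$).
   Context: A partition on $U$ is a set of nonempty pairwise disjoint blocks with union $U$; $\Pi(U)$ is the set of all partitions on $U$; $\operatorname{dit}(\pi)$ is the set of ordered pairs in different blocks; $\sigma\preceq\tau$ iff $\operatorname{dit}(\sigma)\subseteq\operatorname{dit}(\tau)$. For $S\subseteq U\times U$, $\overline S$ is the smallest equivalence relation containing $S$ and $\operatorname{int}(S)=U\times U\setminus\overline{U\times U\setminus S}$. The implication $\sigma\Rightarrow\pi$ is the partition with $\operatorname{dit}(\sigma\Rightarrow\pi)=\operatorname{int}((U\times U\setminus\operatorname{dit}\sigma)\cup\operatorname{dit}\pi)$; equivalently, it is obtained from $\pi$ by replacing each block of $\pi$ contained in some block of $\sigma$ by singletons. -}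

module Defs where

open import Level using (Level; 0ℓ) renaming (suc to lsuc)
open import Data.Product using (Σ; ∃; ∃₂; _×_; _,_)
open import Data.Sum using (_⊎_)
open import Relation.Nullary using (¬_)
open import Relation.Binary.Core using (Rel)
open import Relation.Binary.Structures using (IsEquivalence)
open import Relation.Binary.PropositionalEquality using (_≡_; _≢_)
open import Relation.Binary.Construct.Closure.Equivalence as EqC using (EqClosure)
open import Function.Bundles using (_⇔_)

-- Partitions on a set U, represented by their equivalence relation
-- ("u and v lie in the same block").  Blocks are the equivalence classes.

record Partition (U : Set) : Set₁ where
  field
    rel   : Rel U 0ℓ
    isEq  : IsEquivalence rel
open Partition public

module _ {U : Set} where

  BinRel : Set₁
  BinRel = Rel U 0ℓ

  compl : BinRel → BinRel
  compl S u v = ¬ S u v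

  dit : Partition U → BinRel
  dit π u v = ¬ rel π u v

  _⪯_ : Partition U → Partition U → Set
  σ ⪯ τ = ∀ u v → dit σ u v → dit τ u v

  _≈ₚ_ : Partition U → Partition U → Set
  σ ≈ₚ τ = ∀ u v → rel σ u v ⇔ rel τ u v

  closure : BinRel → BinRel
  closure S = EqClosure S

  int : BinRel → BinRel
  int S = compl (closure (compl S))

  -- σ ⇒ π : the partition whose dit set is
  --   int((U × U \ dit σ) ∪ dit π).
  -- Its equivalence relation is closure(U×U \ S), so that its dit set is
  -- literally int(S).
  impS : Partition U → Partition U → BinRel
  impS σ π u v = compl (dit σ) u v ⊎ dit π u v

  _⇒ₚ_ : Partition U → Partition U → Partition U
  σ ⇒ₚ π = record
    { rel  = closure (compl (impS σ π))
    ; isEq = EqC.isEquivalence (compl (impS σ π)) }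

  Bπ : Partition U → Set₁
  Bπ π = Σ (Partition U) (λ τ → ∃ λ σ → τ ≈ₚ (σ ⇒ₚ π))

  SubsetU : Set₁
  SubsetU = U → Set

  _≐_ : SubsetU → SubsetU → Set
  A ≐ B = ∀ u → A u ⇔ B u

  IsBlock : Partition U → SubsetU → Set
  IsBlock π B = ∃ λ u → ∀ v → B v ⇔ rel π u v

  NonSingleton : SubsetU → Set
  NonSingleton B = ∃₂ λ v w → B v × B w × v ≢ w

  InNS : Partition U → SubsetU → Set
  InNS π B = IsBlock π B × NonSingleton B

  record SubsetNS (π : Partition U) : Set₁ where
    field
      mem    : SubsetU → Set
      mem-ext : ∀ {A B} → A ≐ B → mem A → mem B
      mem-ns : ∀ {B} → mem B → InNS π B
  open SubsetNS public

  _⊆ₙ_ : {π : Partition U} → SubsetNS π → SubsetNS π → Set₁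
  X ⊆ₙ Y = ∀ B → mem X B → mem Y B

  _≈ₙ_ : {π : Partition U} → SubsetNS π → SubsetNS π → Set₁
  X ≈ₙ Y = ∀ B → mem X B ⇔ mem Y B

record OrderIso {a b e₁ e₂ o₁ o₂ : Level}
  (A : Set a) (_≈₁_ : A → A → Set e₁) (_≤₁_ : A → A → Set o₁)
  (B : Set b) (_≈₂_ : B → B → Set e₂) (_≤₂_ : B → B → Set o₂)
  : Set (a Level.⊔ b Level.⊔ e₁ Level.⊔ e₂ Level.⊔ o₁ Level.⊔ o₂) where
  field
    to       : A → B
    from     : B → A
    to-from  : ∀ y → to (from y) ≈₂ y
    from-to  : ∀ x → from (to x) ≈₁ x
    mono     : ∀ x x' → x ≤₁ x' → to x ≤₂ to x'
    reflect  : ∀ x x' → to x ≤₂ to x' → x ≤₁ x'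

-- σ ⇒ π arises from π by splitting into singletons each π-block lying inside a σ-block;
-- every other π-block survives whole, since a single σ-separated pair inside a π-block
-- already glues the whole block in σ ⇒ π.  So τ ∈ B_π is determined by the set of
-- non-singleton π-blocks that τ splits, and each set X of non-singleton blocks is hit:
-- it is the set split by σ ⇒ π for σ keeping the blocks of X and splitting all others.
module Submission where

open import Defs
open import Level using (0ℓ) renaming (suc to lsuc)
open import Data.Product using (∃; ∃₂; proj₁; proj₂; _,_; _×_)
open import Data.Sum using (_⊎_; inj₁; inj₂; [_,_])
open import Data.Empty using (⊥-elim)
open import Function.Base using (id; _∘_)
open import Function.Bundles using (_⇔_; mk⇔; Equivalence)
open import Function.Construct.Composition using (_⇔-∘_)
open import Relation.Nullary using (¬_; Dec; yes; no)
open import Relation.Binary.Core using (Rel; _⇒_)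
open import Relation.Binary.Definitions using (Symmetric; Transitive)
open import Relation.Binary.Structures using (IsEquivalence)
open import Relation.Binary.PropositionalEquality using (_≡_; _≢_; refl)
open import Relation.Binary.Construct.Closure.Equivalence as EqC using ()
open import Relation.Binary.Construct.Closure.Symmetric using (fwd; bwd)
open import Relation.Binary.Construct.Closure.ReflexiveTransitive using (ε; _◅_)
open import Axiom.ExcludedMiddle using (ExcludedMiddle)
open import Axiom.DoubleNegationElimination using (em⇒dne)

open Equivalence using (to; from)

module _ {U : Set} where

  Collapses : Partition U → SubsetU {U} → Set
  Collapses τ B = ∀ a b → B a → B b → rel τ a b

  Resp≐ : (SubsetU {U} → Set) → Set₁
  Resp≐ P = ∀ {A B} → A ≐ B → P A → P B

  ≐-sym : ∀ {A B : SubsetU {U}} → A ≐ B → B ≐ A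
  ≐-sym A≐B u = mk⇔ (from (A≐B u)) (to (A≐B u))

  ¬-resp≐ : ∀ (P : SubsetU {U} → Set) → Resp≐ P → Resp≐ (¬_ ∘ P)
  ¬-resp≐ P resp A≐B ¬PA PB = ¬PA (resp (≐-sym A≐B) PB)

  IsBlock-resp≐ : ∀ π → Resp≐ (IsBlock π)
  IsBlock-resp≐ π A≐B (c , A≐πc) = c , λ v → mk⇔ (to (A≐πc v) ∘ from (A≐B v))
                                                (to (A≐B v) ∘ from (A≐πc v))

  NonSingleton-resp≐ : Resp≐ NonSingleton
  NonSingleton-resp≐ A≐B (v , w , Av , Aw , v≢w) =
    v , w , to (A≐B v) Av , to (A≐B w) Aw , v≢w

  Collapses-resp≐ : ∀ τ → Resp≐ (Collapses τ)
  Collapses-resp≐ τ A≐B collapse a b Ba Bb =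
    collapse a b (from (A≐B a) Ba) (from (A≐B b) Bb)

  ≈ₚ⇒Collapses⇔ : ∀ τ τ' → τ ≈ₚ τ' → ∀ B → Collapses τ B ⇔ Collapses τ' B
  ≈ₚ⇒Collapses⇔ τ τ' τ≈τ' B = mk⇔ (λ c a b Ba Bb → to (τ≈τ' a b) (c a b Ba Bb))
                                  (λ c a b Ba Bb → from (τ≈τ' a b) (c a b Ba Bb))

  InNS-resp≐ : ∀ π → Resp≐ (InNS π)
  InNS-resp≐ π A≐B (isBlock , nonSingleton) =
    IsBlock-resp≐ π A≐B isBlock , NonSingleton-resp≐ A≐B nonSingleton

  module Blocks (π : Partition U) where
    private module π = IsEquivalence (isEq π)

    block-IsBlock : ∀ u → IsBlock π (rel π u)
    block-IsBlock u = u , λ v → mk⇔ id id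

    block-≐ : ∀ {u v} → rel π u v → rel π u ≐ rel π v
    block-≐ uv x = mk⇔ (π.trans (π.sym uv)) (π.trans uv)

    IsBlock⇒≐block : ∀ {B u} → IsBlock π B → B u → B ≐ rel π u
    IsBlock⇒≐block (c , B≐πc) Bu x =
      mk⇔ (λ Bx → π.trans (π.sym cu) (to (B≐πc x) Bx))
          (λ ux → from (B≐πc x) (π.trans cu ux))
      where cu = to (B≐πc _) Bu

    block-InNS : ∀ {u v} → u ≢ v → rel π u v → InNS π (rel π u)
    block-InNS u≢v uv = block-IsBlock _ , (_ , _ , π.refl , uv , u≢v)

    KeptBlocks : (SubsetU {U} → Set) → Rel U 0ℓ
    KeptBlocks P u v = u ≡ v ⊎ (rel π u v × P (rel π u))

    KeptBlocks-sym : ∀ {P} → Resp≐ P → Symmetric (KeptBlocks P)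
    KeptBlocks-sym resp (inj₁ refl)      = inj₁ refl
    KeptBlocks-sym resp (inj₂ (uv , Pu)) = inj₂ (π.sym uv , resp (block-≐ uv) Pu)

    KeptBlocks-trans : ∀ {P} → Transitive (KeptBlocks P)
    KeptBlocks-trans (inj₁ refl)      vw              = vw
    KeptBlocks-trans (inj₂ uv)        (inj₁ refl)     = inj₂ uv
    KeptBlocks-trans (inj₂ (uv , Pu)) (inj₂ (vw , _)) = inj₂ (π.trans uv vw , Pu)

    keepBlocks : (P : SubsetU {U} → Set) → Resp≐ P → Partition U
    keepBlocks P resp = record
      { rel  = KeptBlocks P
      ; isEq = record
        { refl = inj₁ refl ; sym = KeptBlocks-sym resp ; trans = KeptBlocks-trans {P} } }

    keepBlocks-collapses : ∀ (P : SubsetU {U} → Set) (resp : Resp≐ P) {B}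
                         → IsBlock π B → NonSingleton B → Collapses (keepBlocks P resp) B ⇔ P B
    keepBlocks-collapses P resp {B} isBlock (v , w , Bv , Bw , v≢w) = mk⇔ whole glue
      where
      whole : Collapses (keepBlocks P resp) B → P B
      whole collapse with collapse v w Bv Bw
      ... | inj₁ v≡w      = ⊥-elim (v≢w v≡w)
      ... | inj₂ (_ , Pv) = resp (≐-sym (IsBlock⇒≐block isBlock Bv)) Pv
      glue : P B → Collapses (keepBlocks P resp) B
      glue PB a b Ba Bb = inj₂ ( to (IsBlock⇒≐block isBlock Ba b) Bb
                               , resp (IsBlock⇒≐block isBlock Ba) PB)

module Implication (em : ExcludedMiddle 0ℓ) {U : Set} (π : Partition U) where
  open Blocks π
  private
    module π = IsEquivalence (isEq π)
    dne : {P : Set} → ¬ ¬ P → P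
    dne = em⇒dne em

  module _ (σ : Partition U) where
    private
      module σ = IsEquivalence (isEq σ)
      module ⇒ = IsEquivalence (isEq (σ ⇒ₚ π))
      Generator : Rel U 0ℓ
      Generator = compl (impS σ π)

      generator-σ : ∀ {a b} → Generator a b → ¬ rel σ a b
      generator-σ g σab = g (inj₁ (λ ¬σab → ¬σab σab))

      generator-π : ∀ {a b} → Generator a b → rel π a b
      generator-π g = dne (g ∘ inj₂)

    ⇒-intro : ∀ {a b} → ¬ rel σ a b → rel π a b → rel (σ ⇒ₚ π) a b
    ⇒-intro ¬σab πab = EqC.return [ (λ ¬¬σab → ¬¬σab ¬σab) , (λ ¬πab → ¬πab πab) ]

    ⇒-⊆ : rel (σ ⇒ₚ π) ⇒ rel π
    ⇒-⊆ = EqC.fold (isEq π) generator-π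

    ⇒-separated-pair : ∀ {u v} → rel (σ ⇒ₚ π) u v
                     → u ≡ v ⊎ ∃ λ w → ¬ rel σ u w × rel π u w
    ⇒-separated-pair ε           = inj₁ refl
    ⇒-separated-pair (fwd g ◅ _) = inj₂ (_ , generator-σ g , generator-π g)
    ⇒-separated-pair (bwd g ◅ _) = inj₂ (_ , generator-σ g ∘ σ.sym , π.sym (generator-π g))

    ⇒-through : ∀ {a b c} → rel σ a b → ¬ rel σ a c → rel π a c → rel π c b
              → rel (σ ⇒ₚ π) a b
    ⇒-through σab ¬σac πac πcb =
      ⇒.trans (⇒-intro ¬σac πac) (⇒-intro (¬σac ∘ σ.trans σab ∘ σ.sym) πcb)

    -- If σ relates a, b then it cannot relate a to both ends of the separated pair u, w.
    ⇒-collapses-block : ∀ {u w} → ¬ rel σ u w → rel π u w → Collapses (σ ⇒ₚ π) (rel π u)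
    ⇒-collapses-block {u} {w} ¬σuw πuw a b πua πub with em {rel σ a b}
    ... | no ¬σab = ⇒-intro ¬σab (π.trans (π.sym πua) πub)
    ... | yes σab with em {rel σ a u}
    ...   | no ¬σau = ⇒-through σab ¬σau (π.sym πua) πub
    ...   | yes σau = ⇒-through σab (¬σuw ∘ σ.trans (σ.sym σau))
                                (π.trans (π.sym πua) πuw) (π.trans (π.sym πuw) πub)

    ⇒-related⇒collapsed : ∀ {u v} → rel (σ ⇒ₚ π) u v
                        → u ≡ v ⊎ (rel π u v × Collapses (σ ⇒ₚ π) (rel π u))
    ⇒-related⇒collapsed σ⇒πuv with ⇒-separated-pair σ⇒πuv
    ... | inj₁ u≡v              = inj₁ u≡v
    ... | inj₂ (_ , ¬σuw , πuw) = inj₂ (⇒-⊆ σ⇒πuv , ⇒-collapses-block ¬σuw πuw)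

  Bπ-related⇒collapsed : (s : Bπ π) → let τ = proj₁ s in
                         ∀ {u v} → rel τ u v → u ≡ v ⊎ (rel π u v × Collapses τ (rel π u))
  Bπ-related⇒collapsed (τ , σ , τ≈σ⇒π) {u} {v} τuv
    with ⇒-related⇒collapsed σ (to (τ≈σ⇒π u v) τuv)
  ... | inj₁ u≡v              = inj₁ u≡v
  ... | inj₂ (πuv , collapse) =
    inj₂ (πuv , from (≈ₚ⇒Collapses⇔ τ (σ ⇒ₚ π) τ≈σ⇒π (rel π u)) collapse)

  keepBlocks-⇒ : ∀ (P : SubsetU {U} → Set) (resp : Resp≐ P)
               → (keepBlocks P resp ⇒ₚ π) ≈ₚ keepBlocks (¬_ ∘ P) (¬-resp≐ P resp)
  keepBlocks-⇒ P resp u v = mk⇔ split glue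
    where
    σ σ̄ : Partition U
    σ = keepBlocks P resp
    σ̄ = keepBlocks (¬_ ∘ P) (¬-resp≐ P resp)
    split : rel (σ ⇒ₚ π) u v → rel σ̄ u v
    split = EqC.fold (isEq σ̄)
                     (λ g → let πab = ⇒-⊆ σ (EqC.return g) in
                            inj₂ (πab , λ Pa → g (inj₁ λ ¬σab → ¬σab (inj₂ (πab , Pa)))))
    glue : rel σ̄ u v → rel (σ ⇒ₚ π) u v
    glue (inj₁ refl) = ε
    glue (inj₂ (πuv , ¬Pu)) = byCases (em {u ≡ v})
      where
      byCases : Dec (u ≡ v) → rel (σ ⇒ₚ π) u v
      byCases (yes refl) = ε
      byCases (no u≢v)   = ⇒-intro σ [ u≢v , ¬Pu ∘ proj₂ ] πuv

  splitBlocks : Partition U → SubsetNS π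
  splitBlocks τ = record
    { mem     = λ B → InNS π B × ¬ Collapses τ B
    ; mem-ext = λ A≐B (inNS , ¬collapse) →
        InNS-resp≐ π A≐B inNS , ¬-resp≐ (Collapses τ) (Collapses-resp≐ τ) A≐B ¬collapse
    ; mem-ns  = proj₁ }

  separated⇒split : ∀ τ {u v} → rel π u v → ¬ rel τ u v → mem (splitBlocks τ) (rel π u)
  separated⇒split τ πuv ¬τuv =
    block-InNS (¬τuv ∘ IsEquivalence.reflexive (isEq τ)) πuv
    , λ collapse → ¬τuv (collapse _ _ π.refl πuv)

  splitBlocks-mono : ∀ τ τ' → τ ⪯ τ' → splitBlocks τ ⊆ₙ splitBlocks τ'
  splitBlocks-mono τ τ' τ⪯τ' B (inNS , ¬collapse) =
    inNS , λ collapse' → ¬collapse λ a b Ba Bb →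
      dne λ ¬τab → τ⪯τ' a b ¬τab (collapse' a b Ba Bb)

  keep keepOutside : SubsetNS π → Partition U
  keep X        = keepBlocks (mem X) (mem-ext X)
  keepOutside X = keepBlocks (¬_ ∘ mem X) (¬-resp≐ (mem X) (mem-ext X))

  keep-⇒ : ∀ X → (keep X ⇒ₚ π) ≈ₚ keepOutside X
  keep-⇒ X = keepBlocks-⇒ (mem X) (mem-ext X)

  splitBlocks-keep : ∀ X → splitBlocks (keep X ⇒ₚ π) ≈ₙ X
  splitBlocks-keep X B = mk⇔ split⇒mem mem⇒split
    where
    collapses⇔¬mem : InNS π B → Collapses (keep X ⇒ₚ π) B ⇔ (¬ mem X B)
    collapses⇔¬mem (isBlock , nonSingleton) =
      keepBlocks-collapses (¬_ ∘ mem X) (¬-resp≐ (mem X) (mem-ext X)) isBlock nonSingleton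
      ⇔-∘ ≈ₚ⇒Collapses⇔ (keep X ⇒ₚ π) (keepOutside X) (keep-⇒ X) B
    split⇒mem : mem (splitBlocks (keep X ⇒ₚ π)) B → mem X B
    split⇒mem (inNS , ¬collapse) = dne (¬collapse ∘ from (collapses⇔¬mem inNS))
    mem⇒split : mem X B → mem (splitBlocks (keep X ⇒ₚ π)) B
    mem⇒split XB = inNS , λ collapse → to (collapses⇔¬mem inNS) collapse XB
      where inNS = mem-ns X XB

  keep-splitBlocks : (s : Bπ π) → (keep (splitBlocks (proj₁ s)) ⇒ₚ π) ≈ₚ proj₁ s
  keep-splitBlocks s@(τ , _) u v = mk⇔ outside⇒τ τ⇒outside ⇔-∘ keep-⇒ (splitBlocks τ) u v
    where
    outside⇒τ : rel (keepOutside (splitBlocks τ)) u v → rel τ u v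
    outside⇒τ (inj₁ u≡v)            = IsEquivalence.reflexive (isEq τ) u≡v
    outside⇒τ (inj₂ (πuv , ¬split)) = dne (¬split ∘ separated⇒split τ πuv)
    τ⇒outside : rel τ u v → rel (keepOutside (splitBlocks τ)) u v
    τ⇒outside τuv with Bπ-related⇒collapsed s τuv
    ... | inj₁ u≡v              = inj₁ u≡v
    ... | inj₂ (πuv , collapse) = inj₂ (πuv , λ (_ , ¬collapse) → ¬collapse collapse)

  splitBlocks-reflects : (s s' : Bπ π) → splitBlocks (proj₁ s) ⊆ₙ splitBlocks (proj₁ s')
                       → proj₁ s ⪯ proj₁ s'
  splitBlocks-reflects (τ , _) s' split⊆split' u v ¬τuv τ'uv with Bπ-related⇒collapsed s' τ'uv
  ... | inj₁ u≡v               = ¬τuv (IsEquivalence.reflexive (isEq τ) u≡v)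
  ... | inj₂ (πuv , collapse') =
    proj₂ (split⊆split' (rel π u) (separated⇒split τ πuv ¬τuv)) collapse'

  Bπ≅𝒫ns : OrderIso (Bπ π) (λ s t → proj₁ s ≈ₚ proj₁ t) (λ s t → proj₁ s ⪯ proj₁ t)
                     (SubsetNS π) _≈ₙ_ _⊆ₙ_
  Bπ≅𝒫ns = record
    { to      = splitBlocks ∘ proj₁
    ; from    = λ X → keep X ⇒ₚ π , keep X , λ u v → mk⇔ id id
    ; to-from = splitBlocks-keep
    ; from-to = keep-splitBlocks
    ; mono    = λ s s' → splitBlocks-mono (proj₁ s) (proj₁ s')
    ; reflect = splitBlocks-reflects }

mainTheorem12 : ExcludedMiddle 0ℓ → ExcludedMiddle (lsuc 0ℓ)
    → (U : Set) → (∃₂ λ (x y : U) → x ≢ y) → (π : Partition U)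
    → OrderIso (Bπ π) (λ s t → proj₁ s ≈ₚ proj₁ t) (λ s t → proj₁ s ⪯ proj₁ t)
    (SubsetNS π) _≈ₙ_ _⊆ₙ_
mainTheorem12 em _ U _ π = Implication.Bπ≅𝒫ns em π
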